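{- If $uu'$ and $vv'$ are independent edges of $G$, then the pairs $(u,v)$, $(u',v)$, $(u',v')$, $(u,v')$ form a directed four-cycle of $G^+$ in this order (respectively, in the reverse order). In particular, $(u,v)$, $(u',v)$, $(u',v')$ and $(u,v')$ belong to the same strongly connected component of $G^+$.
   Context: $G$ is a graph with a given partition of $V(G)$ into independent sets (partite sets) $V_1,\dots,V_k$; $c(u)$ denotes the index of the partite set containing $u$. Two edges $ab$ and $cd$ of $G$ are independent if the subgraph of $G$ induced by $\{a,b,c,d\}$ has exactly the two edges $ab$ and $cd$. Let $\bar E=\{uv: u\in V_i, v\in V_j, i\neq j\}\setminus E(G)$. The pair-digraph $G^+$ has vertex set all ordered pairs $(u,v)$ with $u\ne v$ in $V(G)$, and arcs: (i) $(u,v)\to(u',v)$ whenever $c(u)=c(v)$, $uu'\in E(G)$, $vu'\notin E(G)$; (ii) $(u,v)\to(u',v)$ whenever $uu'\in E(G)$, $u'v\in\bar E$, and $u,v,u'$ lie in three different partite sets; (iii) $(u,v)\to(u,v')$ whenever $c(u)=c(v')$, $vv'\in E(G)$, $uv\notin E(G)$; (iv) $(u,v)\to(u,v')$ whenever $vv'\in E(G)$, $uv\in\bar E$, and $u,v,v'$ lie in three different partite sets. -}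

module Defs where

open import Data.Nat using (ℕ)
open import Data.Fin using (Fin)
open import Data.Product using (Σ; Σ-syntax; _×_; _,_; proj₁; proj₂)
open import Data.Sum using (_⊎_)
open import Relation.Nullary using (¬_)
open import Relation.Binary.PropositionalEquality using (_≡_; _≢_)
open import Relation.Binary.Construct.Closure.ReflexiveTransitive using (Star)

record PartiteGraph (n k : ℕ) : Set₁ where
  field
    E      : Fin n → Fin n → Set
    E-sym  : ∀ {u v} → E u v → E v u
    E-irr  : ∀ {u} → ¬ E u u
    c      : Fin n → Fin k
    indep  : ∀ {u v} → E u v → c u ≢ c v

module _ {n k : ℕ} (G : PartiteGraph n k) where
  open PartiteGraph G

  V : Set
  V = Fin n

  Ebar : V → V → Set
  Ebar u v = c u ≢ c v × ¬ E u v

  ThreeParts : V → V → V → Set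
  ThreeParts u v w = c u ≢ c v × c u ≢ c w × c v ≢ c w

  record Independent (a b d e : V) : Set where
    field
      ab   : E a b
      de   : E d e
      a≢d  : a ≢ d
      a≢e  : a ≢ e
      b≢d  : b ≢ d
      b≢e  : b ≢ e
      ¬ad  : ¬ E a d
      ¬ae  : ¬ E a e
      ¬bd  : ¬ E b d
      ¬be  : ¬ E b e

  PV : Set
  PV = Σ[ p ∈ V × V ] proj₁ p ≢ proj₂ p

  data Arc : PV → PV → Set where
    rule-i   : ∀ {u v u'} {p q} → c u ≡ c v → E u u' → ¬ E v u'
             → Arc ((u , v) , p) ((u' , v) , q)
    rule-ii  : ∀ {u v u'} {p q} → E u u' → Ebar u' v → ThreeParts u v u'
             → Arc ((u , v) , p) ((u' , v) , q)
    rule-iii : ∀ {u v v'} {p q} → c u ≡ c v' → E v v' → ¬ E u v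
             → Arc ((u , v) , p) ((u , v') , q)
    rule-iv  : ∀ {u v v'} {p q} → E v v' → Ebar u v → ThreeParts u v v'
             → Arc ((u , v) , p) ((u , v') , q)

  Cycle4 : PV → PV → PV → PV → Set
  Cycle4 a b x d = Arc a b × Arc b x × Arc x d × Arc d a

  SameSCC : PV → PV → Set
  SameSCC p q = Star Arc p q × Star Arc q p

{-# OPTIONS --safe #-}
module Submission where

open import Defs
open import Data.Nat using (ℕ)
open import Data.Fin using (_≟_)
open import Data.Product using (_×_; _,_)
open import Data.Sum using (_⊎_; inj₁; inj₂)
open import Function using (_∘_)
open import Relation.Nullary using (yes; no)
open import Relation.Binary.Definitions using (DecidableEquality)
open import Relation.Binary.PropositionalEquality using (_≢_; sym; trans)
open import Relation.Binary.Construct.Closure.ReflexiveTransitive using (ε; _◅_)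

-- Moving the first coordinate of a pair along an edge is an arc of G⁺ as soon
-- as the new pair lies in Ē (by rule (i) or (ii), according to whether the old
-- pair lies in one part), and moving the second coordinate as soon as the old
-- pair lies in Ē (rule (iii) or (iv)).  Around the square of two independent
-- edges this asks for u'v, uv' ∈ Ē in one orientation and uv, u'v' ∈ Ē in the
-- other; these pairs are non-edges by independence, and since c u ≠ c u' and
-- c v ≠ c v' one of the two pairs of part conditions always holds.

crossed-≢ : ∀ {a} {A : Set a} → DecidableEquality A → {x x' y y' : A} →
            x ≢ x' → y ≢ y' → (x' ≢ y × x ≢ y') ⊎ (x ≢ y × x' ≢ y')
crossed-≢ _≟_ {x} {x'} {y} {y'} x≢x' y≢y' with x' ≟ y | x ≟ y'
... | yes x'≡y | _ = inj₂ ((λ x≡y → x≢x' (trans x≡y (sym x'≡y)))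
                        , (λ x'≡y' → y≢y' (trans (sym x'≡y) x'≡y')))
... | no _ | yes x≡y' = inj₂ ((λ x≡y → y≢y' (trans (sym x≡y) x≡y'))
                             , (λ x'≡y' → x≢x' (trans x≡y' (sym x'≡y'))))
... | no x'≢y | no x≢y' = inj₁ (x'≢y , x≢y')

module _ {n k : ℕ} (G : PartiteGraph n k) where
  open PartiteGraph G

  moveˡ : ∀ {s s' t p q} → E s s' → Ebar G s' t → Arc G ((s , t) , p) ((s' , t) , q)
  moveˡ {s} {s'} {t} ss' (s't , ¬s't) with c s ≟ c t
  ... | yes st = rule-i st ss' (¬s't ∘ E-sym)
  ... | no st = rule-ii ss' (s't , ¬s't) (st , indep ss' , s't ∘ sym)

  moveʳ : ∀ {s t t' p q} → E t t' → Ebar G s t → Arc G ((s , t) , p) ((s , t') , q)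
  moveʳ {s} {t} {t'} tt' (st , ¬st) with c s ≟ c t'
  ... | yes st' = rule-iii st' tt' ¬st
  ... | no st' = rule-iv tt' (st , ¬st) (st , st' , indep tt')

  cycle4⇒sameSCC : ∀ {a b x d} → Cycle4 G a b x d →
                   SameSCC G a b × SameSCC G a x × SameSCC G a d
  cycle4⇒sameSCC (ab , bx , xd , da) =
    (ab ◅ ε , bx ◅ xd ◅ da ◅ ε) , (ab ◅ bx ◅ ε , xd ◅ da ◅ ε) , (ab ◅ bx ◅ xd ◅ ε , da ◅ ε)

  either-cycle4⇒sameSCC : ∀ {a b x d} → Cycle4 G a b x d ⊎ Cycle4 G a d x b →
                          SameSCC G a b × SameSCC G a x × SameSCC G a d
  either-cycle4⇒sameSCC (inj₁ abxd) = cycle4⇒sameSCC abxd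
  either-cycle4⇒sameSCC (inj₂ adxb) with cycle4⇒sameSCC adxb
  ... | ad , ax , ab = ab , ax , ad

  module _ {u u' v v' : V G} (ind : Independent G u u' v v') where
    open Independent ind

    p₁ p₂ p₃ p₄ : PV G
    p₁ = (u , v) , a≢d
    p₂ = (u' , v) , b≢d
    p₃ = (u' , v') , b≢e
    p₄ = (u , v') , a≢e

    forward-cycle : c u' ≢ c v → c u ≢ c v' → Cycle4 G p₁ p₂ p₃ p₄
    forward-cycle u'v uv' = moveˡ ab (u'v , ¬bd) , moveʳ de (u'v , ¬bd)
                          , moveˡ (E-sym ab) (uv' , ¬ae) , moveʳ (E-sym de) (uv' , ¬ae)

    backward-cycle : c u ≢ c v → c u' ≢ c v' → Cycle4 G p₁ p₄ p₃ p₂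
    backward-cycle uv u'v' = moveʳ de (uv , ¬ad) , moveˡ ab (u'v' , ¬be)
                           , moveʳ (E-sym de) (u'v' , ¬be) , moveˡ (E-sym ab) (uv , ¬ad)

    independent⇒cycle4 : Cycle4 G p₁ p₂ p₃ p₄ ⊎ Cycle4 G p₁ p₄ p₃ p₂
    independent⇒cycle4 with crossed-≢ _≟_ (indep ab) (indep de)
    ... | inj₁ (u'v , uv') = inj₁ (forward-cycle u'v uv')
    ... | inj₂ (uv , u'v') = inj₂ (backward-cycle uv u'v')

lemma6 : ∀ {n k} (G : PartiteGraph n k) {u u' v v' : V G}
           (ind : Independent G u u' v v') →
           let open Independent ind
               p₁ = (u , v) , a≢d
               p₂ = (u' , v) , b≢d
               p₃ = (u' , v') , b≢e
               p₄ = (u , v') , a≢e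
           in (Cycle4 G p₁ p₂ p₃ p₄ ⊎ Cycle4 G p₁ p₄ p₃ p₂)
              × SameSCC G p₁ p₂ × SameSCC G p₁ p₃ × SameSCC G p₁ p₄
lemma6 G ind = independent⇒cycle4 G ind , either-cycle4⇒sameSCC G (independent⇒cycle4 G ind)
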